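{- Let $p$ be an odd prime and $P,Q\in\mathbb{F}_p\setminus\{0\}$ with $D=P^2-4Q\neq 0$. Let $r$ be a positive integer dividing $p-\left(\frac{D}{p}\right)$. Then the following are equivalent: (i) $r$ divides $s(p)$; (ii) there exist $P',Q'$ in an algebraic closure $\Omega_p$ of $\mathbb{F}_p$ such that $U_n(P',Q')$ is an anti-derived sequence of order $r$ of $U_n(P,Q)$ and $U_{p-1}(P',Q')\,U_{p+1}(P',Q')=0$.
   Context: For $P,Q$ in a field, the Lucas sequences are $U_0=0$, $U_1=1$, $U_{n+2}=PU_{n+1}-QU_n$ and $V_0=2$, $V_1=P$, $V_{n+2}=PV_{n+1}-QV_n$. $\left(\frac{D}{p}\right)$ is the Legendre symbol. The restricted period $r(p)$ is the least positive integer $k$ with $U_k(P,Q)=0$ in $\mathbb{F}_p$; it divides $p-\left(\frac{D}{p}\right)$, and $s(p)=\frac{p-(D/p)}{r(p)}$. A Lucas sequence $U_n(P',Q')$ is an anti-derived sequence of order $r$ of $U_n(P,Q)$ if $U_r(P',Q')\neq 0$ and $U_{nr}(P',Q')/U_r(P',Q')=U_n(P,Q)$ for all $n\ge0$. -}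

module Defs where

open import Level using (Level; _⊔_)
open import Algebra.Bundles using (CommutativeRing)
open import Data.Nat as ℕ using (ℕ; zero; suc; _∸_)
open import Data.Nat.Divisibility as ℕD using (_∣?_)
open import Data.Integer as ℤ using (ℤ; +_; -[1+_])
open import Data.Integer.Divisibility using (_∣_)
open import Data.Integer.Properties using (+-*-commutativeRing)
open import Data.List using (List; []; _∷_; upTo; map; length)
open import Data.List.Relation.Unary.Any using (Any; any?)
open import Data.Product using (_×_; _,_; proj₁; ∃; ∃-syntax)
open import Relation.Nullary using (¬_; yes; no)

module Lucas {c ℓ : Level} (R : CommutativeRing c ℓ) where
  open CommutativeRing R

  -- UV P Q n = (U_n , U_{n+1})
  UV : Carrier → Carrier → ℕ → Carrier × Carrier
  UV P Q zero = 0# , 1#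
  UV P Q (suc n) with UV P Q n
  ... | a , b = b , (P * b - Q * a)

  U : Carrier → Carrier → ℕ → Carrier
  U P Q n = proj₁ (UV P Q n)

-- Lucas U over ℤ; U_n(P,Q) in 𝔽_p is its reduction modulo p.
Uℤ : ℤ → ℤ → ℕ → ℤ
Uℤ = Lucas.U +-*-commutativeRing

disc : ℤ → ℤ → ℤ
disc P Q = P ℤ.* P ℤ.- (+ 4) ℤ.* Q

IsSquareMod : ℕ → ℤ → Set
IsSquareMod p D = Any (λ x → (+ p) ∣ ((+ x) ℤ.* (+ x) ℤ.- D)) (upTo p)

pMinusLegendre : ℕ → ℤ → ℕ
pMinusLegendre p D with p ∣? ℤ.∣ D ∣
... | yes _ = p
... | no _ with any? (λ x → p ∣? ℤ.∣ (+ x) ℤ.* (+ x) ℤ.- D ∣) (upTo p)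
...   | yes _ = p ∸ 1
...   | no _  = suc p

IsRestrictedPeriod : ℕ → ℤ → ℤ → ℕ → Set
IsRestrictedPeriod p P Q k =
  0 ℕ.< k × (+ p) ∣ Uℤ P Q k × (∀ j → 0 ℕ.< j → j ℕ.< k → ¬ ((+ p) ∣ Uℤ P Q j))

module FieldOps {c ℓ : Level} (R : CommutativeRing c ℓ) where
  open CommutativeRing R

  ιℕ : ℕ → Carrier
  ιℕ zero = 0#
  ιℕ (suc n) = 1# + ιℕ n

  ι : ℤ → Carrier
  ι (+ n) = ιℕ n
  ι -[1+ n ] = - ιℕ (suc n)

  -- evaluation of the monic polynomial  x^m + c_{m-1} x^{m-1} + … + c_0
  -- where the list is [c_0, …, c_{m-1}]
  evalMonic : List Carrier → Carrier → Carrier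
  evalMonic [] x = 1#
  evalMonic (a ∷ cs) x = a + x * evalMonic cs x

record AlgClosure (p : ℕ) (c ℓ : Level) : Set (Level.suc (c ⊔ ℓ)) where
  field
    Ωring : CommutativeRing c ℓ
  open CommutativeRing Ωring
  open FieldOps Ωring
  field
    1≉0       : ¬ (1# ≈ 0#)
    inverse   : ∀ x → ¬ (x ≈ 0#) → ∃[ y ] (x * y ≈ 1#)
    charP     : ι (+ p) ≈ 0#
    algClosed : ∀ (cs : List Carrier) → 0 ℕ.< length cs → ∃[ x ] (evalMonic cs x ≈ 0#)
    algebraic : ∀ x → ∃[ cs ] (evalMonic (map ι cs) x ≈ 0#)

module _ {p : ℕ} {c ℓ : Level} (Ω : AlgClosure p c ℓ) where
  open AlgClosure Ω
  open CommutativeRing Ωring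
  open FieldOps Ωring
  open Lucas Ωring

  AntiDerived : Carrier → Carrier → ℕ → ℤ → ℤ → Set ℓ
  AntiDerived P' Q' r P Q =
    ¬ (U P' Q' r ≈ 0#) ×
    (∀ n → U P' Q' (n ℕ.* r) ≈ U P' Q' r * ι (Uℤ P Q n))

  ProdVanishes : Carrier → Carrier → Set ℓ
  ProdVanishes P' Q' = U P' Q' (p ∸ 1) * U P' Q' (suc p) ≈ 0#

{-# OPTIONS --safe #-}
module Submission where

-- Over Ω factor x² - P x + Q = (x - α)(x - β).  Since D = (α - β)² ≠ 0, Binet's formula
-- (α - β) U_n = αⁿ - βⁿ shows p ∣ U_n ⟺ αⁿ = βⁿ ⟺ r(p) ∣ n.  Choosing r-th roots α', β'
-- of α, β, the pair P' = α' + β', Q' = α'β' is anti-derived of order r, and for any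
-- anti-derived sequence U'_{nr} = U'_r U_n vanishes exactly when U_n does.  Writing
-- N = p - (D/p) = m r = r(p) s, we get r ∣ s ⟺ r(p) ∣ m ⟺ U'_N = 0.  Finally
-- U'_{p-1} U'_{p+1} = 0 forces U'_N = 0: otherwise U' vanishes at the index N ± 2,
-- so α^{N±2} = β^{N±2} besides α^N = β^N, whence α² = β², α = -β and p ∣ P.

open import Level using (Level)
open import Algebra.Bundles using (CommutativeRing)
open import Data.Nat as ℕ using (ℕ; zero; suc; _∸_)
import Data.Nat.Properties as ℕP
open import Data.Nat.Divisibility as ℕD using () renaming (_∣_ to _∣ℕ_)
open import Data.Nat.DivMod using (_%_; _/_; m≡m%n+[m/n]*n; m%n<n)
open import Data.Nat.GCD using (module Bézout)
open import Data.Nat.Coprimality using (Coprime; coprime-Bézout)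
open import Data.Nat.Primality using (Prime; prime⇒irreducible; ¬prime[0])
open import Data.Integer as ℤ using (ℤ; +_; -[1+_]; _⊖_)
import Data.Integer.Properties as ℤP
open import Data.Integer.Divisibility using (_∣_)
open import Data.List using ([]; _∷_; replicate; upTo)
open import Data.List.Relation.Unary.Any using (any?)
open import Data.Maybe using (Maybe; just; nothing)
open import Data.Product using (_×_; _,_; proj₁; proj₂; ∃-syntax)
open import Data.Sum using (_⊎_; inj₁; inj₂)
open import Data.Empty using (⊥-elim)
open import Function.Bundles using (_⇔_; mk⇔; Equivalence)
open import Function.Construct.Composition using (_⇔-∘_)
open import Function.Construct.Symmetry using (⇔-sym)
open import Relation.Nullary using (¬_; yes; no)
open import Relation.Nullary.Decidable using (decidable-stable)
open import Relation.Binary.PropositionalEquality as ≡ using (_≡_; _≢_)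
import Algebra.Solver.Ring.AlmostCommutativeRing as ACR
import Algebra.Solver.Ring
open import Defs

module CanonicalMap {c ℓ : Level} (R : CommutativeRing c ℓ) where
  open CommutativeRing R
  open FieldOps R
  open import Algebra.Properties.Ring ring using (-0#≈0#; -‿distribˡ-*; -‿distribʳ-*; -‿involutive; -‿+-comm)
  open import Algebra.Properties.Monoid.Mult +-monoid using (×-homo-+) renaming (_×_ to _·_)
  open import Algebra.Properties.Semiring.Mult semiring using (×1-homo-*)
  open import Relation.Binary.Reasoning.Setoid setoid

  ιℕ≡·1# : ∀ n → ιℕ n ≡ n · 1#
  ιℕ≡·1# zero = ≡.refl
  ιℕ≡·1# (suc n) = ≡.cong (λ x → 1# + x) (ιℕ≡·1# n)

  ιℕ-homo-+ : ∀ m n → ιℕ (m ℕ.+ n) ≈ ιℕ m + ιℕ n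
  ιℕ-homo-+ m n rewrite ιℕ≡·1# (m ℕ.+ n) | ιℕ≡·1# m | ιℕ≡·1# n = ×-homo-+ 1# m n

  ιℕ-homo-* : ∀ m n → ιℕ (m ℕ.* n) ≈ ιℕ m * ιℕ n
  ιℕ-homo-* m n rewrite ιℕ≡·1# (m ℕ.* n) | ιℕ≡·1# m | ιℕ≡·1# n = ×1-homo-* m n

  ι-homo-neg : ∀ z → ι (ℤ.- z) ≈ - ι z
  ι-homo-neg (+ zero) = sym -0#≈0#
  ι-homo-neg (+ suc n) = refl
  ι-homo-neg -[1+ n ] = sym (-‿involutive _)

  ι-homo-⊖ : ∀ m n → ι (m ⊖ n) ≈ ιℕ m - ιℕ n
  ι-homo-⊖ m zero rewrite ℤP.⊖-≥ {m} {0} ℕ.z≤n =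
    sym (trans (+-congˡ -0#≈0#) (+-identityʳ _))
  ι-homo-⊖ zero (suc n) rewrite ℤP.⊖-< {0} {suc n} (ℕ.s≤s ℕ.z≤n) = sym (+-identityˡ _)
  ι-homo-⊖ (suc m) (suc n) rewrite ℤP.[1+m]⊖[1+n]≡m⊖n m n = begin
    ι (m ⊖ n)                        ≈⟨ ι-homo-⊖ m n ⟩
    ιℕ m - ιℕ n                      ≈⟨ +-congʳ (+-identityˡ _) ⟨
    (0# + ιℕ m) - ιℕ n               ≈⟨ +-congʳ (+-congʳ (-‿inverseʳ 1#)) ⟨
    ((1# - 1#) + ιℕ m) - ιℕ n        ≈⟨ +-congʳ (+-assoc 1# (- 1#) (ιℕ m)) ⟩
    (1# + (- 1# + ιℕ m)) - ιℕ n      ≈⟨ +-congʳ (+-congˡ (+-comm (- 1#) (ιℕ m))) ⟩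
    (1# + (ιℕ m - 1#)) - ιℕ n        ≈⟨ +-congʳ (+-assoc 1# (ιℕ m) (- 1#)) ⟨
    ((1# + ιℕ m) - 1#) - ιℕ n        ≈⟨ +-assoc (1# + ιℕ m) (- 1#) (- ιℕ n) ⟩
    (1# + ιℕ m) + (- 1# - ιℕ n)      ≈⟨ +-congˡ (-‿+-comm 1# (ιℕ n)) ⟩
    (1# + ιℕ m) - (1# + ιℕ n)        ∎

  ι-homo-+ : ∀ x y → ι (x ℤ.+ y) ≈ ι x + ι y
  ι-homo-+ (+ m) (+ n) = ιℕ-homo-+ m n
  ι-homo-+ (+ m) -[1+ n ] = ι-homo-⊖ m (suc n)
  ι-homo-+ -[1+ m ] (+ n) = trans (ι-homo-⊖ n (suc m)) (+-comm _ _)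
  ι-homo-+ -[1+ m ] -[1+ n ] = begin
    - ιℕ (suc (suc (m ℕ.+ n)))       ≡⟨ ≡.cong (λ k → - ιℕ k) (ℕP.+-suc (suc m) n) ⟨
    - ιℕ (suc m ℕ.+ suc n)           ≈⟨ -‿cong (ιℕ-homo-+ (suc m) (suc n)) ⟩
    - (ιℕ (suc m) + ιℕ (suc n))    ≈⟨ -‿+-comm _ _ ⟨
    - ιℕ (suc m) - ιℕ (suc n)      ∎

  ι-homo-minus : ∀ x y → ι (x ℤ.- y) ≈ ι x - ι y
  ι-homo-minus x y = trans (ι-homo-+ x (ℤ.- y)) (+-congˡ (ι-homo-neg y))

  ι-homo-*-pos : ∀ a y → ι (+ a ℤ.* y) ≈ ιℕ a * ι y
  ι-homo-*-pos a (+ b) = begin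
    ι (+ a ℤ.* + b)  ≡⟨ ≡.cong ι (ℤP.pos-* a b) ⟨
    ιℕ (a ℕ.* b)     ≈⟨ ιℕ-homo-* a b ⟩
    ιℕ a * ιℕ b      ∎
  ι-homo-*-pos a -[1+ b ] = begin
    ι (+ a ℤ.* ℤ.- + suc b)      ≡⟨ ≡.cong ι (ℤP.neg-distribʳ-* (+ a) (+ suc b)) ⟨
    ι (ℤ.- (+ a ℤ.* + suc b))    ≈⟨ ι-homo-neg (+ a ℤ.* + suc b) ⟩
    - ι (+ a ℤ.* + suc b)        ≈⟨ -‿cong (ι-homo-*-pos a (+ suc b)) ⟩
    - (ιℕ a * ιℕ (suc b))        ≈⟨ -‿distribʳ-* _ _ ⟩
    ιℕ a * - ιℕ (suc b)          ∎

  ι-homo-* : ∀ x y → ι (x ℤ.* y) ≈ ι x * ι y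
  ι-homo-* (+ a) y = ι-homo-*-pos a y
  ι-homo-* -[1+ a ] y = begin
    ι (ℤ.- + suc a ℤ.* y)        ≡⟨ ≡.cong ι (ℤP.neg-distribˡ-* (+ suc a) y) ⟨
    ι (ℤ.- (+ suc a ℤ.* y))      ≈⟨ ι-homo-neg (+ suc a ℤ.* y) ⟩
    - ι (+ suc a ℤ.* y)          ≈⟨ -‿cong (ι-homo-*-pos (suc a) y) ⟩
    - (ιℕ (suc a) * ι y)         ≈⟨ -‿distribˡ-* _ _ ⟩
    - ιℕ (suc a) * ι y           ∎

  ι-morphism : CommutativeRing.rawRing ℤP.+-*-commutativeRing ACR.-Raw-AlmostCommutative⟶ ACR.fromCommutativeRing R
  ι-morphism = record
    { ⟦_⟧ = ι ; +-homo = ι-homo-+ ; *-homo = ι-homo-* ; -‿homo = ι-homo-neg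
    ; 0-homo = refl ; 1-homo = +-identityʳ 1# }

  ι-≈-if-≡ : ∀ x y → Maybe (ι x ≈ ι y)
  ι-≈-if-≡ x y with x ℤ.≟ y
  ... | yes ≡.refl = just refl
  ... | no _ = nothing

  open Algebra.Solver.Ring _ (ACR.fromCommutativeRing R) ι-morphism ι-≈-if-≡ public

module LucasProperties {c ℓ : Level} (R : CommutativeRing c ℓ) where
  open CommutativeRing R
  open FieldOps R using (ι)
  open Lucas R
  open CanonicalMap R
  open import Algebra.Properties.Semiring.Exp semiring using (_^_)
  open import Relation.Binary.Reasoning.Setoid setoid

  U-binet : ∀ {a b x y} → x ≈ a + b → y ≈ a * b → ∀ n → (a - b) * U x y n ≈ a ^ n - b ^ n
  U-binet _ _ zero = trans (zeroʳ _) (sym (-‿inverseʳ 1#))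
  U-binet {a} {b} _ _ (suc zero) =
    trans (*-identityʳ _) (sym (+-cong (*-identityʳ a) (-‿cong (*-identityʳ b))))
  U-binet {a} {b} {x} {y} x≈a+b y≈ab (suc (suc n)) = begin
    (a - b) * (x * U x y (suc n) - y * U x y n)
      ≈⟨ distrib-over-recurrence a b x y (U x y (suc n)) (U x y n) ⟩
    x * ((a - b) * U x y (suc n)) - y * ((a - b) * U x y n)
      ≈⟨ +-cong (*-cong x≈a+b (U-binet x≈a+b y≈ab (suc n)))
                (-‿cong (*-cong y≈ab (U-binet x≈a+b y≈ab n))) ⟩
    (a + b) * (a ^ suc n - b ^ suc n) - (a * b) * (a ^ n - b ^ n)
      ≈⟨ power-recurrence a b (a ^ n) (b ^ n) ⟩
    a ^ suc (suc n) - b ^ suc (suc n) ∎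
    where
    distrib-over-recurrence : ∀ a b x y u v →
      (a - b) * (x * u - y * v) ≈ x * ((a - b) * u) - y * ((a - b) * v)
    distrib-over-recurrence = solve 6 (λ a b x y u v →
      (a :- b) :* (x :* u :- y :* v) := x :* ((a :- b) :* u) :- y :* ((a :- b) :* v)) refl
    power-recurrence : ∀ a b aⁿ bⁿ →
      (a + b) * (a * aⁿ - b * bⁿ) - (a * b) * (aⁿ - bⁿ) ≈ a * (a * aⁿ) - b * (b * bⁿ)
    power-recurrence = solve 4 (λ a b aⁿ bⁿ →
      (a :+ b) :* (a :* aⁿ :- b :* bⁿ) :- (a :* b) :* (aⁿ :- bⁿ) := a :* (a :* aⁿ) :- b :* (b :* bⁿ)) refl

  module _ {x y : Carrier} where

    U-shift-by-zero : ∀ {k} → U x y k ≈ 0# → ∀ n → U x y (n ℕ.+ k) ≈ U x y (suc k) * U x y n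
    U-shift-by-zero Uk≈0 zero = trans Uk≈0 (sym (zeroʳ _))
    U-shift-by-zero Uk≈0 (suc zero) = sym (*-identityʳ _)
    U-shift-by-zero {k} Uk≈0 (suc (suc n)) = begin
      x * U x y (suc n ℕ.+ k) - y * U x y (n ℕ.+ k)
        ≈⟨ +-cong (*-congˡ (U-shift-by-zero Uk≈0 (suc n))) (-‿cong (*-congˡ (U-shift-by-zero Uk≈0 n))) ⟩
      x * (w * U x y (suc n)) - y * (w * U x y n)
        ≈⟨ factor-out x y w (U x y (suc n)) (U x y n) ⟩
      w * (x * U x y (suc n) - y * U x y n) ∎
      where
      w : Carrier
      w = U x y (suc k)
      factor-out : ∀ x y w u v → x * (w * u) - y * (w * v) ≈ w * (x * u - y * v)
      factor-out = solve 5 (λ x y w u v →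
        x :* (w :* u) :- y :* (w :* v) := w :* (x :* u :- y :* v)) refl

    U-zero-multiples : ∀ {k} → U x y k ≈ 0# → ∀ j → U x y (j ℕ.* k) ≈ 0#
    U-zero-multiples Uk≈0 zero = refl
    U-zero-multiples {k} Uk≈0 (suc j) = begin
      U x y (k ℕ.+ j ℕ.* k)              ≡⟨ ≡.cong (U x y) (ℕP.+-comm k (j ℕ.* k)) ⟩
      U x y (j ℕ.* k ℕ.+ k)              ≈⟨ U-shift-by-zero Uk≈0 (j ℕ.* k) ⟩
      U x y (suc k) * U x y (j ℕ.* k)    ≈⟨ *-congˡ (U-zero-multiples Uk≈0 j) ⟩
      U x y (suc k) * 0#                 ≈⟨ zeroʳ _ ⟩
      0#                                 ∎

  ι-U : ∀ P Q n → ι (Uℤ P Q n) ≈ U (ι P) (ι Q) n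
  ι-U P Q zero = refl
  ι-U P Q (suc zero) = +-identityʳ 1#
  ι-U P Q (suc (suc n)) = begin
    ι (P ℤ.* Uℤ P Q (suc n) ℤ.- Q ℤ.* Uℤ P Q n)
      ≈⟨ ι-homo-minus (P ℤ.* Uℤ P Q (suc n)) (Q ℤ.* Uℤ P Q n) ⟩
    ι (P ℤ.* Uℤ P Q (suc n)) - ι (Q ℤ.* Uℤ P Q n)
      ≈⟨ +-cong (ι-homo-* P _) (-‿cong (ι-homo-* Q _)) ⟩
    ι P * ι (Uℤ P Q (suc n)) - ι Q * ι (Uℤ P Q n)
      ≈⟨ +-cong (*-congˡ (ι-U P Q (suc n))) (-‿cong (*-congˡ (ι-U P Q n))) ⟩
    ι P * U (ι P) (ι Q) (suc n) - ι Q * U (ι P) (ι Q) n ∎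

module Field {c ℓ : Level} (R : CommutativeRing c ℓ) where

  open CommutativeRing R
  open Lucas R
  open CanonicalMap R
  open LucasProperties R
  open import Algebra.Properties.Ring ring using (x∙y⁻¹≈ε⇒x≈y; x≈y⇒x∙y⁻¹≈ε)
  open import Algebra.Properties.Semiring.Exp semiring using (_^_; ^-congˡ; ^-congʳ; ^-homo-*; ^-assocʳ)
  open import Relation.Binary.Reasoning.Setoid setoid

  module Properties (1≉0 : 1# ≉ 0#) (inverse : ∀ x → x ≉ 0# → ∃[ y ] (x * y ≈ 1#)) where

    *-cancelˡ-≉0 : ∀ {a u v} → a ≉ 0# → a * u ≈ a * v → u ≈ v
    *-cancelˡ-≉0 {a} {u} {v} a≉0 au≈av with inverse a a≉0
    ... | a⁻¹ , aa⁻¹≈1 = begin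
      u                ≈⟨ *-identityˡ u ⟨
      1# * u           ≈⟨ *-congʳ (trans (*-comm a⁻¹ a) aa⁻¹≈1) ⟨
      (a⁻¹ * a) * u    ≈⟨ *-assoc a⁻¹ a u ⟩
      a⁻¹ * (a * u)    ≈⟨ *-congˡ au≈av ⟩
      a⁻¹ * (a * v)    ≈⟨ *-assoc a⁻¹ a v ⟨
      (a⁻¹ * a) * v    ≈⟨ *-congʳ (trans (*-comm a⁻¹ a) aa⁻¹≈1) ⟩
      1# * v           ≈⟨ *-identityˡ v ⟩
      v                ∎

    *-≈0⇒≈0 : ∀ {a u} → a ≉ 0# → a * u ≈ 0# → u ≈ 0#
    *-≈0⇒≈0 a≉0 au≈0 = *-cancelˡ-≉0 a≉0 (trans au≈0 (sym (zeroʳ _)))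

    *-≉0 : ∀ {a b} → a ≉ 0# → b ≉ 0# → a * b ≉ 0#
    *-≉0 a≉0 b≉0 ab≈0 = b≉0 (*-≈0⇒≈0 a≉0 ab≈0)

    ^-≉0 : ∀ {a} → a ≉ 0# → ∀ n → a ^ n ≉ 0#
    ^-≉0 a≉0 zero = 1≉0
    ^-≉0 a≉0 (suc n) = *-≉0 a≉0 (^-≉0 a≉0 n)

    ^-*-comm : ∀ a m n → a ^ (m ℕ.* n) ≈ (a ^ n) ^ m
    ^-*-comm a m n = trans (^-congʳ a (ℕP.*-comm m n)) (sym (^-assocʳ a n m))

    equal-powers-cancel : ∀ {a b} m n → b ≉ 0# → a ^ m ≈ b ^ m →
                          a ^ (n ℕ.+ m) ≈ b ^ (n ℕ.+ m) → a ^ n ≈ b ^ n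
    equal-powers-cancel {a} {b} m n b≉0 aᵐ≈bᵐ aⁿ⁺ᵐ≈bⁿ⁺ᵐ =
      *-cancelˡ-≉0 (^-≉0 b≉0 m) (begin
        b ^ m * a ^ n    ≈⟨ *-comm _ _ ⟩
        a ^ n * b ^ m    ≈⟨ *-congˡ aᵐ≈bᵐ ⟨
        a ^ n * a ^ m    ≈⟨ ^-homo-* a n m ⟨
        a ^ (n ℕ.+ m)    ≈⟨ aⁿ⁺ᵐ≈bⁿ⁺ᵐ ⟩
        b ^ (n ℕ.+ m)    ≈⟨ ^-homo-* b n m ⟩
        b ^ n * b ^ m    ≈⟨ *-comm _ _ ⟩
        b ^ m * b ^ n    ∎)

    equal-powers⇔multiple : ∀ {a b ρ} .{{_ : ℕ.NonZero ρ}} → b ≉ 0# → a ^ ρ ≈ b ^ ρ →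
                            (∀ j → 0 ℕ.< j → j ℕ.< ρ → a ^ j ≉ b ^ j) →
                            ∀ k → a ^ k ≈ b ^ k ⇔ ρ ∣ℕ k
    equal-powers⇔multiple {a} {b} {ρ} b≉0 aᵖ≈bᵖ minimal k = mk⇔ (multiple k) (equal k)
      where
      equal : ∀ k → ρ ∣ℕ k → a ^ k ≈ b ^ k
      equal _ (ℕD.divides q ≡.refl) = begin
        a ^ (q ℕ.* ρ)    ≈⟨ ^-*-comm a q ρ ⟩
        (a ^ ρ) ^ q      ≈⟨ ^-congˡ q aᵖ≈bᵖ ⟩
        (b ^ ρ) ^ q      ≈⟨ ^-*-comm b q ρ ⟨
        b ^ (q ℕ.* ρ)    ∎
      multiple : ∀ k → a ^ k ≈ b ^ k → ρ ∣ℕ k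
      multiple k aᵏ≈bᵏ = from-remainder (k % ρ) ≡.refl (m%n<n k ρ) equal-at-remainder
        where
        equal-at-remainder : a ^ (k % ρ) ≈ b ^ (k % ρ)
        equal-at-remainder = equal-powers-cancel (k / ρ ℕ.* ρ) (k % ρ) b≉0 (equal _ (ℕD.n∣m*n (k / ρ)))
          (≡.subst (λ i → a ^ i ≈ b ^ i) (m≡m%n+[m/n]*n k ρ) aᵏ≈bᵏ)
        from-remainder : ∀ t → k % ρ ≡ t → t ℕ.< ρ → a ^ t ≈ b ^ t → ρ ∣ℕ k
        from-remainder zero k%ρ≡0 _ _ = ℕD.m%n≡0⇒n∣m k ρ k%ρ≡0
        from-remainder (suc t) _ t<ρ aᵗ≈bᵗ = ⊥-elim (minimal (suc t) (ℕ.s≤s ℕ.z≤n) t<ρ aᵗ≈bᵗ)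

    ≉⇒-≉0 : ∀ {a b} → a ≉ b → a - b ≉ 0#
    ≉⇒-≉0 a≉b a-b≈0 = a≉b (x∙y⁻¹≈ε⇒x≈y _ _ a-b≈0)

    equal-squares⇒opposite : ∀ {a b} → a ≉ b → a * a ≈ b * b → a + b ≈ 0#
    equal-squares⇒opposite {a} {b} a≉b a²≈b² =
      *-≈0⇒≈0 (≉⇒-≉0 a≉b)
        (trans (difference-of-squares a b) (x≈y⇒x∙y⁻¹≈ε a²≈b²))
      where
      difference-of-squares : ∀ a b → (a - b) * (a + b) ≈ a * a - b * b
      difference-of-squares = solve 2 (λ a b → (a :- b) :* (a :+ b) := a :* a :- b :* b) refl

    module _ {a b x y} (x≈a+b : x ≈ a + b) (y≈ab : y ≈ a * b) (a≉b : a ≉ b) where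

      U≈0⇔equal-powers : ∀ n → U x y n ≈ 0# ⇔ a ^ n ≈ b ^ n
      U≈0⇔equal-powers n = mk⇔
        (λ Uₙ≈0 → x∙y⁻¹≈ε⇒x≈y _ _ (trans (sym binet) (trans (*-congˡ Uₙ≈0) (zeroʳ _))))
        (λ aⁿ≈bⁿ → *-≈0⇒≈0 (≉⇒-≉0 a≉b) (trans binet (x≈y⇒x∙y⁻¹≈ε aⁿ≈bⁿ)))
        where
        binet : (a - b) * U x y n ≈ a ^ n - b ^ n
        binet = U-binet x≈a+b y≈ab n

      -- Compare Binet's formulas for (a', b') and (a, b) = (a'ʳ, b'ʳ);
      -- the factor a' - b' cancels since (a' - b') U' r = a - b.
      U-of-roots : ∀ {a' b' r} → a' ^ r ≈ a → b' ^ r ≈ b →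
                   let U' = U (a' + b') (a' * b') in
                   U' r ≉ 0# × (∀ n → U' (n ℕ.* r) ≈ U' r * U x y n)
      U-of-roots {a'} {b'} {r} a'ʳ≈a b'ʳ≈b = U'r≉0 , U'-multiples
        where
        U' : ℕ → Carrier
        U' = U (a' + b') (a' * b')
        binet' : ∀ n → (a' - b') * U' n ≈ a' ^ n - b' ^ n
        binet' = U-binet refl refl
        root-powers : ∀ n → a' ^ (n ℕ.* r) - b' ^ (n ℕ.* r) ≈ a ^ n - b ^ n
        root-powers n = +-cong (trans (^-*-comm a' n r) (^-congˡ n a'ʳ≈a))
                               (-‿cong (trans (^-*-comm b' n r) (^-congˡ n b'ʳ≈b)))
        d'U'r≈d : (a' - b') * U' r ≈ a - b
        d'U'r≈d = trans (binet' r) (+-cong a'ʳ≈a (-‿cong b'ʳ≈b))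
        U'r≉0 : U' r ≉ 0#
        U'r≉0 U'r≈0 = ≉⇒-≉0 a≉b (trans (sym d'U'r≈d) (trans (*-congˡ U'r≈0) (zeroʳ _)))
        d'≉0 : a' - b' ≉ 0#
        d'≉0 d'≈0 = ≉⇒-≉0 a≉b (trans (sym d'U'r≈d) (trans (*-congʳ d'≈0) (zeroˡ _)))
        U'-multiples : ∀ n → U' (n ℕ.* r) ≈ U' r * U x y n
        U'-multiples n = *-cancelˡ-≉0 d'≉0 (begin
          (a' - b') * U' (n ℕ.* r)         ≈⟨ binet' (n ℕ.* r) ⟩
          a' ^ (n ℕ.* r) - b' ^ (n ℕ.* r)  ≈⟨ root-powers n ⟩
          a ^ n - b ^ n                    ≈⟨ U-binet x≈a+b y≈ab n ⟨
          (a - b) * U x y n                ≈⟨ *-congʳ d'U'r≈d ⟨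
          ((a' - b') * U' r) * U x y n     ≈⟨ *-assoc _ _ _ ⟩
          (a' - b') * (U' r * U x y n)     ∎)

module AlgebraicClosureProperties {p : ℕ} {c ℓ : Level} (Ω : AlgClosure p c ℓ) where
  open AlgClosure Ω
  open CommutativeRing Ωring
  open FieldOps Ωring
  open Lucas Ωring
  open CanonicalMap Ωring
  open LucasProperties Ωring
  open Field.Properties Ωring 1≉0 inverse public
  open import Algebra.Properties.Ring ring using (-0#≈0#; -‿involutive; x∙y⁻¹≈ε⇒x≈y)
  open import Algebra.Properties.Semiring.Exp semiring using (_^_)
  open import Relation.Binary.Reasoning.Setoid setoid

  ιℕ-multiple≈0 : ∀ {n} → ιℕ n ≈ 0# → ∀ q → ιℕ (q ℕ.* n) ≈ 0#
  ιℕ-multiple≈0 {n} ιn≈0 q = trans (ιℕ-homo-* q n) (trans (*-congˡ ιn≈0) (zeroʳ _))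

  1+multiple≢multiple : ∀ {u v} → ιℕ u ≈ 0# → ιℕ v ≈ 0# → ∀ x y → 1 ℕ.+ x ℕ.* u ≢ y ℕ.* v
  1+multiple≢multiple {u} {v} ιu≈0 ιv≈0 x y eq = 1≉0 (begin
    1#                   ≈⟨ +-identityʳ 1# ⟨
    1# + 0#              ≈⟨ +-congˡ (ιℕ-multiple≈0 ιu≈0 x) ⟨
    ιℕ (1 ℕ.+ x ℕ.* u)   ≡⟨ ≡.cong ιℕ eq ⟩
    ιℕ (y ℕ.* v)         ≈⟨ ιℕ-multiple≈0 ιv≈0 y ⟩
    0#                   ∎)

  ιℕ≈0⇔p∣ : Prime p → ∀ n → ιℕ n ≈ 0# ⇔ p ∣ℕ n
  ιℕ≈0⇔p∣ p-prime n = mk⇔ ιn≈0⇒p∣n (λ{ (ℕD.divides q ≡.refl) → ιℕ-multiple≈0 charP q })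
    where
    ιn≈0⇒p∣n : ιℕ n ≈ 0# → p ∣ℕ n
    ιn≈0⇒p∣n ιn≈0 with p ℕD.∣? n
    ... | yes p∣n = p∣n
    ... | no p∤n = ⊥-elim (no-Bézout-identity (coprime-Bézout coprime))
      where
      coprime : Coprime p n
      coprime (d∣p , d∣n) with prime⇒irreducible p-prime d∣p
      ... | inj₁ d≡1 = d≡1
      ... | inj₂ ≡.refl = ⊥-elim (p∤n d∣n)
      no-Bézout-identity : ¬ Bézout.Identity 1 p n
      no-Bézout-identity (Bézout.+- x y eq) = 1+multiple≢multiple ιn≈0 charP y x eq
      no-Bézout-identity (Bézout.-+ x y eq) = 1+multiple≢multiple charP ιn≈0 x y eq

  ι≈0⇔p∣ : Prime p → ∀ z → ι z ≈ 0# ⇔ (+ p) ∣ z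
  ι≈0⇔p∣ p-prime (+ n) = ιℕ≈0⇔p∣ p-prime n
  ι≈0⇔p∣ p-prime -[1+ n ] = mk⇔
    (λ -ιn≈0 → Equivalence.to (ιℕ≈0⇔p∣ p-prime (suc n))
                 (trans (sym (-‿involutive _)) (trans (-‿cong -ιn≈0) -0#≈0#)))
    (λ p∣n → trans (-‿cong (Equivalence.from (ιℕ≈0⇔p∣ p-prime (suc n)) p∣n)) -0#≈0#)

  nth-root : ∀ a n → ∃[ x ] (x ^ suc n ≈ a)
  nth-root a n with algClosed ((- a) ∷ replicate n 0#) (ℕ.s≤s ℕ.z≤n)
  ... | x , xⁿ⁺¹-a≈0 = x , x∙y⁻¹≈ε⇒x≈y _ _ (trans (+-comm _ _) (trans (+-congˡ (*-congˡ (sym (monomial n)))) xⁿ⁺¹-a≈0))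
    where
    monomial : ∀ k → evalMonic (replicate k 0#) x ≈ x ^ k
    monomial zero = refl
    monomial (suc k) = trans (+-identityˡ _) (*-congˡ (monomial k))

  quadratic-splits : ∀ A B → ∃[ a ] ∃[ b ] (A ≈ a + b × B ≈ a * b)
  quadratic-splits A B with algClosed (B ∷ (- A) ∷ []) (ℕ.s≤s ℕ.z≤n)
  ... | a , root = a , A - a , sum-of-roots A a , (begin
    B                                ≈⟨ +-identityʳ B ⟨
    B + 0#                           ≈⟨ +-congˡ -0#≈0# ⟨
    B - 0#                           ≈⟨ +-congˡ (-‿cong (trans (+-congˡ (*-congˡ (+-congˡ (sym (*-identityʳ a))))) root)) ⟨
    B - (B + a * (- A + a))          ≈⟨ product-of-roots A B a ⟩
    a * (A - a)                      ∎)
    where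
    sum-of-roots : ∀ A a → A ≈ a + (A - a)
    sum-of-roots = solve 2 (λ A a → A := a :+ (A :- a)) refl
    product-of-roots : ∀ A B a → B - (B + a * (- A + a)) ≈ a * (A - a)
    product-of-roots = solve 3 (λ A B a → B :- (B :+ a :* (:- A :+ a)) := a :* (A :- a)) refl

  module _ {P' Q' r P Q} (anti : AntiDerived Ω P' Q' r P Q) where

    AntiDerived-zeros : ∀ n → U P' Q' (n ℕ.* r) ≈ 0# ⇔ ι (Uℤ P Q n) ≈ 0#
    AntiDerived-zeros n = mk⇔
      (λ U'nr≈0 → *-≈0⇒≈0 (proj₁ anti) (trans (sym (proj₂ anti n)) U'nr≈0))
      (λ Un≈0 → trans (proj₂ anti n) (trans (*-congˡ Un≈0) (zeroʳ _)))

    AntiDerived-reflects-zeros : ∀ n → U P' Q' n ≈ 0# → ι (Uℤ P Q n) ≈ 0#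
    AntiDerived-reflects-zeros n U'n≈0 = Equivalence.to (AntiDerived-zeros n)
      (≡.subst (λ i → U P' Q' i ≈ 0#) (ℕP.*-comm r n) (U-zero-multiples U'n≈0 r))

module LucasSequenceModP {p : ℕ} {c ℓ : Level} (Ω : AlgClosure p c ℓ) (p-prime : Prime p)
    (P Q : ℤ) (p∤P : ¬ (+ p) ∣ P) (p∤Q : ¬ (+ p) ∣ Q) (p∤D : ¬ (+ p) ∣ disc P Q) where
  open AlgClosure Ω
  open CommutativeRing Ωring
  open FieldOps Ωring
  open Lucas Ωring
  open CanonicalMap Ωring
  open LucasProperties Ωring
  open AlgebraicClosureProperties Ω
  open import Algebra.Properties.Ring ring using (x≈y⇒x∙y⁻¹≈ε)
  open import Algebra.Properties.Semiring.Exp semiring using (_^_)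
  open import Relation.Binary.Reasoning.Setoid setoid

  p∤⇒ι≉0 : ∀ z → ¬ (+ p) ∣ z → ι z ≉ 0#
  p∤⇒ι≉0 z p∤z ιz≈0 = p∤z (Equivalence.to (ι≈0⇔p∣ p-prime z) ιz≈0)

  α β : Carrier
  α = proj₁ (quadratic-splits (ι P) (ι Q))
  β = proj₁ (proj₂ (quadratic-splits (ι P) (ι Q)))

  P≈α+β : ι P ≈ α + β
  P≈α+β = proj₁ (proj₂ (proj₂ (quadratic-splits (ι P) (ι Q))))

  Q≈αβ : ι Q ≈ α * β
  Q≈αβ = proj₂ (proj₂ (proj₂ (quadratic-splits (ι P) (ι Q))))

  D≈[α-β]² : ι (disc P Q) ≈ (α - β) * (α - β)
  D≈[α-β]² = begin
    ι (P ℤ.* P ℤ.- + 4 ℤ.* Q)              ≈⟨ ι-homo-minus (P ℤ.* P) (+ 4 ℤ.* Q) ⟩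
    ι (P ℤ.* P) - ι (+ 4 ℤ.* Q)            ≈⟨ +-cong (ι-homo-* P P) (-‿cong (ι-homo-* (+ 4) Q)) ⟩
    ι P * ι P - ι (+ 4) * ι Q              ≈⟨ +-cong (*-cong P≈α+β P≈α+β) (-‿cong (*-congˡ Q≈αβ)) ⟩
    (α + β) * (α + β) - ι (+ 4) * (α * β)  ≈⟨ discriminant α β ⟩
    (α - β) * (α - β)                      ∎
    where
    discriminant : ∀ a b → (a + b) * (a + b) - ι (+ 4) * (a * b) ≈ (a - b) * (a - b)
    discriminant = solve 2 (λ a b → (a :+ b) :* (a :+ b) :- con (+ 4) :* (a :* b) := (a :- b) :* (a :- b)) refl

  α≉β : α ≉ β
  α≉β α≈β = p∤⇒ι≉0 (disc P Q) p∤D (trans D≈[α-β]² (trans (*-congʳ (x≈y⇒x∙y⁻¹≈ε α≈β)) (zeroˡ _)))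

  β≉0 : β ≉ 0#
  β≉0 β≈0 = p∤⇒ι≉0 Q p∤Q (trans Q≈αβ (trans (*-congˡ β≈0) (zeroʳ α)))

  U≈0⇔equal-root-powers : ∀ n → ι (Uℤ P Q n) ≈ 0# ⇔ α ^ n ≈ β ^ n
  U≈0⇔equal-root-powers n =
    U≈0⇔equal-powers P≈α+β Q≈αβ α≉β n ⇔-∘ mk⇔ (trans (sym (ι-U P Q n))) (trans (ι-U P Q n))

  no-equal-root-powers-two-apart : ∀ K → α ^ K ≈ β ^ K → α ^ (2 ℕ.+ K) ≉ β ^ (2 ℕ.+ K)
  no-equal-root-powers-two-apart K αᴷ≈βᴷ αᴷ⁺²≈βᴷ⁺² = p∤⇒ι≉0 P p∤P (trans P≈α+β
    (equal-squares⇒opposite α≉β (begin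
      α * α     ≈⟨ *-congˡ (*-identityʳ α) ⟨
      α ^ 2     ≈⟨ equal-powers-cancel K 2 β≉0 αᴷ≈βᴷ αᴷ⁺²≈βᴷ⁺² ⟩
      β ^ 2     ≈⟨ *-congˡ (*-identityʳ β) ⟩
      β * β     ∎)))

  anti-derived-exists : ∀ r → 0 ℕ.< r → ∃[ P' ] ∃[ Q' ] AntiDerived Ω P' Q' r P Q
  anti-derived-exists (suc r') _ = α' + β' , α' * β' , proj₁ roots-U ,
      λ n → trans (proj₂ roots-U n) (*-congˡ (sym (ι-U P Q n)))
    where
    α' β' : Carrier
    α' = proj₁ (nth-root α r')
    β' = proj₁ (nth-root β r')
    U' : ℕ → Carrier
    U' = U (α' + β') (α' * β')
    roots-U : U' (suc r') ≉ 0# × (∀ n → U' (n ℕ.* suc r') ≈ U' (suc r') * U (ι P) (ι Q) n)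
    roots-U = U-of-roots P≈α+β Q≈αβ α≉β (proj₂ (nth-root α r')) (proj₂ (nth-root β r'))

  module _ {ρ} (period : IsRestrictedPeriod p P Q ρ) where
    private
      instance
        ρ≢0 : ℕ.NonZero ρ
        ρ≢0 = ℕ.>-nonZero (proj₁ period)

    ρ∣⇔U≈0 : ∀ n → ρ ∣ℕ n ⇔ ι (Uℤ P Q n) ≈ 0#
    ρ∣⇔U≈0 n = ⇔-sym (equal-powers⇔multiple β≉0 αᵖ≈βᵖ minimal n ⇔-∘ U≈0⇔equal-root-powers n)
      where
      αᵖ≈βᵖ : α ^ ρ ≈ β ^ ρ
      αᵖ≈βᵖ = Equivalence.to (U≈0⇔equal-root-powers ρ)
                (Equivalence.from (ι≈0⇔p∣ p-prime (Uℤ P Q ρ)) (proj₁ (proj₂ period)))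
      minimal : ∀ j → 0 ℕ.< j → j ℕ.< ρ → α ^ j ≉ β ^ j
      minimal j 0<j j<ρ αʲ≈βʲ = proj₂ (proj₂ period) j 0<j j<ρ
        (Equivalence.to (ι≈0⇔p∣ p-prime (Uℤ P Q j)) (Equivalence.from (U≈0⇔equal-root-powers j) αʲ≈βʲ))

    -- Equality in Ω is not decidable, so a vanishing factor of the product cannot be
    -- picked out; instead ρ ∤ m is refuted, using decidability of ρ ∣ m.
    ρ∣m⇔ProdVanishes : ∀ {P' Q' r m N K} → AntiDerived Ω P' Q' r P Q →
                       N ≡ m ℕ.* r → ρ ∣ℕ N → N ≡ K ⊎ N ≡ 2 ℕ.+ K →
                       ρ ∣ℕ m ⇔ U P' Q' K * U P' Q' (2 ℕ.+ K) ≈ 0#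
    ρ∣m⇔ProdVanishes {P'} {Q'} {r} {m} {N} {K} anti N≡mr ρ∣N N≡K∨K+2 =
      mk⇔ (λ ρ∣m → vanishing-factor N≡K∨K+2 (ρ∣m⇒U'N≈0 ρ∣m))
          (λ product≈0 → decidable-stable (ρ ℕD.∣? m) (λ ρ∤m → nonvanishing N≡K∨K+2 ρ∤m product≈0))
      where
      U' : ℕ → Carrier
      U' = U P' Q'
      ρ∣m⇒U'N≈0 : ρ ∣ℕ m → U' N ≈ 0#
      ρ∣m⇒U'N≈0 ρ∣m = ≡.subst (λ i → U' i ≈ 0#) (≡.sym N≡mr)
        (Equivalence.from (AntiDerived-zeros anti m) (Equivalence.to (ρ∣⇔U≈0 m) ρ∣m))
      U'N≉0 : ¬ ρ ∣ℕ m → U' N ≉ 0#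
      U'N≉0 ρ∤m U'N≈0 = ρ∤m (Equivalence.from (ρ∣⇔U≈0 m)
        (Equivalence.to (AntiDerived-zeros anti m) (≡.subst (λ i → U' i ≈ 0#) N≡mr U'N≈0)))
      αᴺ≈βᴺ : α ^ N ≈ β ^ N
      αᴺ≈βᴺ = Equivalence.to (U≈0⇔equal-root-powers N) (Equivalence.to (ρ∣⇔U≈0 N) ρ∣N)
      U'≈0⇒equal : ∀ n → U' n ≈ 0# → α ^ n ≈ β ^ n
      U'≈0⇒equal n U'n≈0 = Equivalence.to (U≈0⇔equal-root-powers n) (AntiDerived-reflects-zeros anti n U'n≈0)
      vanishing-factor : N ≡ K ⊎ N ≡ 2 ℕ.+ K → U' N ≈ 0# → U' K * U' (2 ℕ.+ K) ≈ 0#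
      vanishing-factor (inj₁ ≡.refl) U'N≈0 = trans (*-congʳ U'N≈0) (zeroˡ _)
      vanishing-factor (inj₂ ≡.refl) U'N≈0 = trans (*-congˡ U'N≈0) (zeroʳ _)
      nonvanishing : N ≡ K ⊎ N ≡ 2 ℕ.+ K → ¬ ρ ∣ℕ m → U' K * U' (2 ℕ.+ K) ≉ 0#
      nonvanishing (inj₁ ≡.refl) ρ∤m = *-≉0 (U'N≉0 ρ∤m)
        (λ U'K+2≈0 → no-equal-root-powers-two-apart K αᴺ≈βᴺ (U'≈0⇒equal (2 ℕ.+ K) U'K+2≈0))
      nonvanishing (inj₂ ≡.refl) ρ∤m = *-≉0
        (λ U'K≈0 → no-equal-root-powers-two-apart K (U'≈0⇒equal K U'K≈0) αᴺ≈βᴺ) (U'N≉0 ρ∤m)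

pMinusLegendre≡p∓1 : ∀ p D → ¬ (+ p) ∣ D → pMinusLegendre p D ≡ p ∸ 1 ⊎ pMinusLegendre p D ≡ suc p
pMinusLegendre≡p∓1 p D p∤D with p ℕD.∣? ℤ.∣ D ∣
... | yes p∣D = ⊥-elim (p∤D p∣D)
... | no _ with any? (λ x → p ℕD.∣? ℤ.∣ (+ x) ℤ.* (+ x) ℤ.- D ∣) (upTo p)
...   | yes _ = inj₁ ≡.refl
...   | no _ = inj₂ ≡.refl

cross-divisibility : ∀ {ρ s m r} .{{_ : ℕ.NonZero ρ}} .{{_ : ℕ.NonZero r}} →
                     ρ ℕ.* s ≡ m ℕ.* r → r ∣ℕ s ⇔ ρ ∣ℕ m
cross-divisibility {ρ} {s} {m} {r} ρs≡mr = mk⇔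
  (λ r∣s → ℕD.*-cancelʳ-∣ r (≡.subst (ρ ℕ.* r ∣ℕ_) ρs≡mr (ℕD.*-monoʳ-∣ ρ r∣s)))
  (λ ρ∣m → ℕD.*-cancelˡ-∣ ρ (≡.subst (ρ ℕ.* r ∣ℕ_) (≡.sym ρs≡mr) (ℕD.*-monoˡ-∣ r ρ∣m)))

open import Data.Nat using (_*_; _<_)

lemma3p3 : ∀ {c ℓ : Level} (p : ℕ) → Prime p → p ≢ 2
           → (P Q : ℤ) → ¬ ((+ p) ∣ P) → ¬ ((+ p) ∣ Q) → ¬ ((+ p) ∣ disc P Q)
           → (r : ℕ) → 0 < r → r ∣ℕ pMinusLegendre p (disc P Q)
           → (Ω : AlgClosure p c ℓ)
           → (ρ s : ℕ) → IsRestrictedPeriod p P Q ρ → ρ * s ≡ pMinusLegendre p (disc P Q)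
           → (r ∣ℕ s)
             ⇔ (∃[ P' ] ∃[ Q' ]
                  (AntiDerived Ω P' Q' r P Q
                   × ProdVanishes Ω P' Q'))
lemma3p3 zero p-prime = ⊥-elim (¬prime[0] p-prime)
lemma3p3 (suc k) p-prime _ P Q p∤P p∤Q p∤D r 0<r (ℕD.divides m N≡mr) Ω ρ s period ρs≡N =
  mk⇔ (λ r∣s → let (P' , Q' , anti) = anti-derived-exists r 0<r in
                P' , Q' , anti , Equivalence.to (ρ∣m⇔vanishes anti) (Equivalence.to r∣s⇔ρ∣m r∣s))
      (λ (P' , Q' , anti , vanishes) →
                Equivalence.from r∣s⇔ρ∣m (Equivalence.from (ρ∣m⇔vanishes anti) vanishes))
  where
  open LucasSequenceModP Ω p-prime P Q p∤P p∤Q p∤D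
  instance
    ρ≢0 : ℕ.NonZero ρ
    ρ≢0 = ℕ.>-nonZero (proj₁ period)
    r≢0 : ℕ.NonZero r
    r≢0 = ℕ.>-nonZero 0<r
  r∣s⇔ρ∣m : r ∣ℕ s ⇔ ρ ∣ℕ m
  r∣s⇔ρ∣m = cross-divisibility (≡.trans ρs≡N N≡mr)
  ρ∣m⇔vanishes : ∀ {P' Q'} → AntiDerived Ω P' Q' r P Q → ρ ∣ℕ m ⇔ ProdVanishes Ω P' Q'
  ρ∣m⇔vanishes anti = ρ∣m⇔ProdVanishes period anti N≡mr
    (ℕD.divides s (≡.trans (≡.sym ρs≡N) (ℕP.*-comm ρ s))) (pMinusLegendre≡p∓1 (suc k) (disc P Q) p∤D)
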